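{- (a) For every $s\ge 4$ there exists a strongly connected digraph $D$ such that $\overrightarrow{rc}(D)=\overrightarrow{src}(D)\ge s$ and $\overrightarrow{rvc}(D)=\overrightarrow{srvc}(D)=3$. (b) For every $s\ge 2$ there exists a strongly connected digraph $D$ such that $\overrightarrow{rc}(D)=\overrightarrow{src}(D)=3$ and $\overrightarrow{rvc}(D)=\overrightarrow{srvc}(D)=s$.
   Context: All digraphs are finite and simple. A (directed) path is a sequence of distinct vertices $x_0,\dots,x_\ell$ with each $x_{i-1}x_i$ an arc; its length is $\ell$. A digraph is strongly connected if for every ordered pair $(u,v)$ there is a $u$–$v$ path; a $u$–$v$ geodesic is a shortest $u$–$v$ path. An arc-coloured path is rainbow if its arcs have distinct colours; an arc-colouring is rainbow connected (resp. strongly rainbow connected) if every ordered pair $(u,v)$ is joined by a rainbow $u$–$v$ path (resp. geodesic), and $\overrightarrow{rc}(D)$ (resp. $\overrightarrow{src}(D)$) is the minimum number of colours of such an arc-colouring. A vertex-coloured path is rainbow if its internal vertices have distinct colours; a vertex-colouring is rainbow vertex-connected (resp. strongly rainbow vertex-connected) if every ordered pair $(u,v)$ is joined by a rainbow $u$–$v$ path (resp. geodesic), and $\overrightarrow{rvc}(D)$ (resp. $\overrightarrow{srvc}(D)$) is the minimum number of colours of such a vertex-colouring. -}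

module Defs where

open import Data.Nat using (ℕ; _≤_)
open import Data.Fin using (Fin)
open import Data.Bool using (Bool; true; false)
open import Data.List using (List; []; _∷_; map; length)
open import Data.List.Relation.Unary.Unique.Propositional using (Unique)
open import Data.Product using (_×_; _,_; ∃)
open import Relation.Binary.PropositionalEquality using (_≡_)

-- Multiple arcs are impossible
-- by construction; a pair of opposite arcs uv, vu is allowed (as usual for digraphs).
record Digraph : Set where
  field
    n        : ℕ
    adj      : Fin n → Fin n → Bool
    loopless : ∀ v → adj v v ≡ false
open Digraph public

Arc : (D : Digraph) → Fin (n D) → Fin (n D) → Set
Arc D x y = adj D x y ≡ true

-- Walk D u ys v : the sequence u , ys[0] , … , last ys is a walk from u to v
-- (consecutive vertices joined by arcs). Its length is length ys.
data Walk (D : Digraph) : Fin (n D) → List (Fin (n D)) → Fin (n D) → Set where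
  stop : ∀ {u} → Walk D u [] u
  step : ∀ {u w ys v} → Arc D u w → Walk D w ys v → Walk D u (w ∷ ys) v

IsPath : (D : Digraph) → Fin (n D) → List (Fin (n D)) → Fin (n D) → Set
IsPath D u ys v = Walk D u ys v × Unique (u ∷ ys)

IsGeodesic : (D : Digraph) → Fin (n D) → List (Fin (n D)) → Fin (n D) → Set
IsGeodesic D u ys v =
  IsPath D u ys v × (∀ zs → IsPath D u zs v → length ys ≤ length zs)

StronglyConnected : Digraph → Set
StronglyConnected D = ∀ (u v : Fin (n D)) → ∃ λ ys → IsPath D u ys v

arcsOf : ∀ {m} → Fin m → List (Fin m) → List (Fin m × Fin m)
arcsOf u []       = []
arcsOf u (w ∷ ys) = (u , w) ∷ arcsOf w ys

-- internal vertices of the path u ∷ ys (all of ys except its last element)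
internal : ∀ {m} → List (Fin m) → List (Fin m)
internal []           = []
internal (w ∷ [])     = []
internal (w ∷ x ∷ ys) = w ∷ internal (x ∷ ys)

-- An arc-colouring with (at most) k colours assigns a colour to every ordered
-- pair; only the values on arcs matter.
ArcColouring : Digraph → ℕ → Set
ArcColouring D k = Fin (n D) → Fin (n D) → Fin k

VertexColouring : Digraph → ℕ → Set
VertexColouring D k = Fin (n D) → Fin k

ArcRainbow : ∀ {D k} → ArcColouring D k → Fin (n D) → List (Fin (n D)) → Set
ArcRainbow c u ys = Unique (map (λ { (x , y) → c x y }) (arcsOf u ys))

VertexRainbow : ∀ {D k} → VertexColouring D k → List (Fin (n D)) → Set
VertexRainbow c ys = Unique (map c (internal ys))

RainbowConnected : (D : Digraph) → ∀ {k} → ArcColouring D k → Set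
RainbowConnected D c =
  ∀ u v → ∃ λ ys → IsPath D u ys v × ArcRainbow {D} c u ys

StronglyRainbowConnected : (D : Digraph) → ∀ {k} → ArcColouring D k → Set
StronglyRainbowConnected D c =
  ∀ u v → ∃ λ ys → IsGeodesic D u ys v × ArcRainbow {D} c u ys

RainbowVertexConnected : (D : Digraph) → ∀ {k} → VertexColouring D k → Set
RainbowVertexConnected D c =
  ∀ u v → ∃ λ ys → IsPath D u ys v × VertexRainbow {D} c ys

StronglyRainbowVertexConnected : (D : Digraph) → ∀ {k} → VertexColouring D k → Set
StronglyRainbowVertexConnected D c =
  ∀ u v → ∃ λ ys → IsGeodesic D u ys v × VertexRainbow {D} c ys

IsMin : (ℕ → Set) → ℕ → Set
IsMin P k = P k × (∀ j → P j → k ≤ j)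

rc≡ : Digraph → ℕ → Set
rc≡ D = IsMin (λ k → ∃ λ (c : ArcColouring D k) → RainbowConnected D c)

src≡ : Digraph → ℕ → Set
src≡ D = IsMin (λ k → ∃ λ (c : ArcColouring D k) → StronglyRainbowConnected D c)

rvc≡ : Digraph → ℕ → Set
rvc≡ D = IsMin (λ k → ∃ λ (c : VertexColouring D k) → RainbowVertexConnected D c)

srvc≡ : Digraph → ℕ → Set
srvc≡ D = IsMin (λ k → ∃ λ (c : VertexColouring D k) → StronglyRainbowVertexConnected D c)

-- (a) Glue m ≥ 2 directed triangles C → Aᵢ → Bᵢ → C at C (a windmill). For i ≠ j every
-- Aᵢ–Bⱼ walk must cross, in turn, the only arcs leaving {Aᵢ}, leaving {Aᵢ, Bᵢ}, entering
-- {Aⱼ, Bⱼ} and entering {Bⱼ}, so it contains AᵢBᵢ, BᵢC, CAⱼ, AⱼBⱼ. Any two of the m + 2 arcs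
-- B₀C, CA₁, AᵢBᵢ lie on one such walk, whence rc ≥ m + 2; giving B→C, C→A and each AᵢBᵢ their
-- own colour makes every geodesic rainbow. Colouring C, the Aᵢ and the Bᵢ with three colours
-- makes every geodesic vertex-rainbow, and the geodesic A₀B₀CA₁B₁ has three internal vertices.
--
-- (b) Attach a pendant 2-cycle Xᵢ ⇄ Lᵢ to each vertex of the complete digraph on X₀ … X₍ₛ₋₁₎.
-- Colouring arcs by their type L→X, X→X, X→L makes every geodesic rainbow, and d(L₀, L₁) = 3
-- forces three colours. Every Lᵢ–Lⱼ walk passes through Xᵢ and Xⱼ, so the hubs need s distinct
-- vertex colours, and colouring Xᵢ and Lᵢ with i suffices.
--
-- Geodesics are certified by a function that vanishes on the diagonal and drops by at most one
-- along an arc: it bounds the length of every walk from below.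

module Submission where

open import Defs
open import Data.Bool using (Bool; true; false; not; if_then_else_)
open import Data.Empty using (⊥-elim)
open import Data.Fin using (Fin; zero; suc)
open import Data.Fin.Patterns using (0F; 1F; 2F)
open import Data.Fin.Properties using (_≟_; injective⇒≤; +↔⊎; 1↔⊤)
open import Data.List using (List; []; _∷_; map; length; lookup)
open import Data.List.Membership.Propositional using (_∈_)
open import Data.List.Membership.Propositional.Properties using (∈-lookup)
open import Data.List.Properties using (length-map)
open import Data.List.Relation.Unary.All as All using (All; []; _∷_)
import Data.List.Relation.Unary.All.Properties as All
open import Data.List.Relation.Unary.AllPairs as AllPairs using (AllPairs; []; _∷_)
open import Data.List.Relation.Unary.Any using (here; there)
open import Data.List.Relation.Unary.Unique.Propositional using (Unique)
import Data.List.Relation.Unary.Unique.Propositional.Properties as Unique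
open import Data.Nat using (ℕ; suc; _+_; _≤_; z≤n; s≤s; s≤s⁻¹)
open import Data.Nat.Properties using (≤-trans; ≤-reflexive; m≤n+m; ≤ᵇ⇒≤; module ≤-Reasoning)
open import Data.Product using (_×_; _,_; proj₁; proj₂; Σ; ∃)
open import Data.Sum using (_⊎_; inj₁; inj₂)
open import Data.Sum.Function.Propositional using (_⊎-↔_)
open import Data.Unit using (⊤; tt)
open import Function.Bundles using (Inverse; _↔_)
open import Function.Construct.Composition using (_↔-∘_)
open import Function.Definitions using (Injective)
open import Function.Base using (_∘_; _∋_)
open import Relation.Binary.PropositionalEquality
open import Relation.Nullary using (does; yes; no)
open import Relation.Nullary.Decidable using (dec-true; dec-false; decidable-stable)

Unique⇒lookup-injective : ∀ {A : Set} {xs : List A} → Unique xs → Injective _≡_ _≡_ (lookup xs)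
Unique⇒lookup-injective {xs = _ ∷ _} (_ ∷ _) {zero} {zero} _ = refl
Unique⇒lookup-injective {xs = _ ∷ _} (x∉xs ∷ _) {zero} {suc j} x≡xⱼ = ⊥-elim (All.lookup x∉xs (∈-lookup j) x≡xⱼ)
Unique⇒lookup-injective {xs = _ ∷ _} (x∉xs ∷ _) {suc i} {zero} xᵢ≡x = ⊥-elim (All.lookup x∉xs (∈-lookup i) (sym xᵢ≡x))
Unique⇒lookup-injective {xs = _ ∷ _} (_ ∷ u) {suc i} {suc j} xᵢ≡xⱼ = cong suc (Unique⇒lookup-injective u xᵢ≡xⱼ)

Unique⇒length≤ : ∀ {k} {xs : List (Fin k)} → Unique xs → length xs ≤ k
Unique⇒length≤ u = injective⇒≤ (Unique⇒lookup-injective u)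

Unique-map⇒≢ : ∀ {A B : Set} {g : A → B} {xs : List A} {a b} →
               Unique (map g xs) → a ∈ xs → b ∈ xs → a ≢ b → g a ≢ g b
Unique-map⇒≢ {xs = _ ∷ _} _ (here refl) (here refl) a≢b _ = a≢b refl
Unique-map⇒≢ {xs = _ ∷ _} (ga∉ ∷ _) (here refl) (there b∈) _ = All.lookup (All.map⁻ ga∉) b∈
Unique-map⇒≢ {xs = _ ∷ _} (gb∉ ∷ _) (there a∈) (here refl) _ ga≡gb = All.lookup (All.map⁻ gb∉) a∈ (sym ga≡gb)
Unique-map⇒≢ {xs = _ ∷ _} (_ ∷ u) (there a∈) (there b∈) = Unique-map⇒≢ u a∈ b∈

Unique-map-restrict : ∀ {A B : Set} {g : A → B} {xs es : List A} →
                      Unique (map g xs) → All (_∈ xs) es → AllPairs _≢_ es → Unique (map g es)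
Unique-map-restrict g-xs []          []           = []
Unique-map-restrict g-xs (e∈ ∷ es∈) (e∉es ∷ es-distinct) =
  All.map⁺ (All.zipWith (λ (e′∈ , e≢e′) → Unique-map⇒≢ g-xs e∈ e′∈ e≢e′) (es∈ , e∉es)) ∷
  Unique-map-restrict g-xs es∈ es-distinct

≢-preserving⇒≤ : ∀ {m k} (f : Fin m → Fin k) → (∀ {p q} → p ≢ q → f p ≢ f q) → m ≤ k
≢-preserving⇒≤ f preserves = injective⇒≤ λ {p} {q} fp≡fq → decidable-stable (p ≟ q) (λ p≢q → preserves p≢q fp≡fq)

length-arcsOf : ∀ {m} (u : Fin m) ys → length (arcsOf u ys) ≡ length ys
length-arcsOf u []       = refl
length-arcsOf u (w ∷ ys) = cong suc (length-arcsOf w ys)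

length≤suc-internal : ∀ {m} (ys : List (Fin m)) → length ys ≤ suc (length (internal ys))
length≤suc-internal []           = z≤n
length≤suc-internal (w ∷ [])     = s≤s z≤n
length≤suc-internal (w ∷ x ∷ ys) = s≤s (length≤suc-internal (x ∷ ys))

tail∈internal : ∀ {m} {u p q : Fin m} ys → (p , q) ∈ arcsOf u ys → p ≢ u → p ∈ internal ys
tail∈internal (w ∷ ys)     (here refl) p≢u = ⊥-elim (p≢u refl)
tail∈internal {p = p} (w ∷ x ∷ ys) (there pq∈) p≢u with p ≟ w
... | yes p≡w = here p≡w
... | no  p≢w = there (tail∈internal (x ∷ ys) pq∈ p≢w)

module _ {D : Digraph} where

  head∈internal : ∀ {u ys v p q} → Walk D u ys v → (p , q) ∈ arcsOf u ys → q ≢ v → q ∈ internal ys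
  head∈internal (step _ stop)          (here refl) q≢v = ⊥-elim (q≢v refl)
  head∈internal (step _ (step _ _))    (here refl) _   = here refl
  head∈internal (step _ walk@(step _ _)) (there pq∈) q≢v = there (head∈internal walk pq∈ q≢v)

  walk-length≥ : (d : Fin (n D) → Fin (n D) → ℕ) → (∀ v → d v v ≡ 0) →
                 (∀ {x y} z → Arc D x y → d x z ≤ suc (d y z)) →
                 ∀ {u ys v} → Walk D u ys v → d u v ≤ length ys
  walk-length≥ d d-refl d-arc stop            = ≤-reflexive (d-refl _)
  walk-length≥ d d-refl d-arc {v = v} (step xy walk) =
    ≤-trans (d-arc v xy) (s≤s (walk-length≥ d d-refl d-arc walk))

  cut-arc∈arcsOf : (S : Fin (n D) → Bool) {p q : Fin (n D)} →
                   (∀ {a b} → Arc D a b → S a ≡ true → S b ≡ false → (a , b) ≡ (p , q)) →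
                   ∀ {u ys v} → Walk D u ys v → S u ≡ true → S v ≡ false → (p , q) ∈ arcsOf u ys
  cut-arc∈arcsOf S leaving stop Su Sv with () ← trans (sym Su) Sv
  cut-arc∈arcsOf S leaving (step {w = w} uw walk) Su Sv with S w in Sw
  ... | true  = there (cut-arc∈arcsOf S leaving walk Sw Sv)
  ... | false = here (sym (leaving uw Su Sw))

  strong⇒rainbow : ∀ {k} {c : ArcColouring D k} → StronglyRainbowConnected D c → RainbowConnected D c
  strong⇒rainbow strong u v with strong u v
  ... | ys , (path , _) , rainbow = ys , path , rainbow

  strong⇒rainbowVertex : ∀ {k} {c : VertexColouring D k} →
                         StronglyRainbowVertexConnected D c → RainbowVertexConnected D c
  strong⇒rainbowVertex strong u v with strong u v
  ... | ys , (path , _) , rainbow = ys , path , rainbow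

  rainbow⇒stronglyConnected : ∀ {k} {c : ArcColouring D k} → RainbowConnected D c → StronglyConnected D
  rainbow⇒stronglyConnected rainbow u v with rainbow u v
  ... | ys , path , _ = ys , path

  rainbow-colours≥ : ∀ {k ℓ u v} → (∀ {ys} → Walk D u ys v → ℓ ≤ length ys) →
                     (c : ArcColouring D k) → RainbowConnected D c → ℓ ≤ k
  rainbow-colours≥ {u = u} {v} long c rainbow with rainbow u v
  ... | ys , (walk , _) , distinct = begin
    _                               ≤⟨ long walk ⟩
    length ys                       ≡⟨ sym (length-arcsOf u ys) ⟩
    length (arcsOf u ys)            ≡⟨ sym (length-map _ (arcsOf u ys)) ⟩
    length (map _ (arcsOf u ys))    ≤⟨ Unique⇒length≤ distinct ⟩
    _                               ∎
    where open ≤-Reasoning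

  rainbowVertex-colours≥ : ∀ {k ℓ u v} → (∀ {ys} → Walk D u ys v → suc ℓ ≤ length ys) →
                           (c : VertexColouring D k) → RainbowVertexConnected D c → ℓ ≤ k
  rainbowVertex-colours≥ {u = u} {v} long c rainbow with rainbow u v
  ... | ys , (walk , _) , distinct = begin
    _                               ≤⟨ s≤s⁻¹ (≤-trans (long walk) (length≤suc-internal ys)) ⟩
    length (internal ys)            ≡⟨ sym (length-map c (internal ys)) ⟩
    length (map c (internal ys))    ≤⟨ Unique⇒length≤ distinct ⟩
    _                               ∎
    where open ≤-Reasoning

  rc≡∧src≡ : ∀ {k} (c : ArcColouring D k) → StronglyRainbowConnected D c →
             (∀ {j} (c′ : ArcColouring D j) → RainbowConnected D c′ → k ≤ j) → rc≡ D k × src≡ D k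
  rc≡∧src≡ c strong bound =
    ((c , strong⇒rainbow strong) , λ _ (c′ , rainbow) → bound c′ rainbow) ,
    ((c , strong) , λ _ (c′ , strong′) → bound c′ (strong⇒rainbow strong′))

  rvc≡∧srvc≡ : ∀ {k} (c : VertexColouring D k) → StronglyRainbowVertexConnected D c →
               (∀ {j} (c′ : VertexColouring D j) → RainbowVertexConnected D c′ → k ≤ j) →
               rvc≡ D k × srvc≡ D k
  rvc≡∧srvc≡ c strong bound =
    ((c , strong⇒rainbowVertex strong) , λ _ (c′ , rainbow) → bound c′ rainbow) ,
    ((c , strong) , λ _ (c′ , strong′) → bound c′ (strong⇒rainbowVertex strong′))

module Presentation {V : Set} {N : ℕ} (vertex : Fin N ↔ V)
  (adjV : V → V → Bool) (adjV-irrefl : ∀ v → adjV v v ≡ false)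
  (dist : V → V → ℕ) (dist-refl : ∀ v → dist v v ≡ 0)
  (dist-arc : ∀ x y z → adjV x y ≡ true → dist x z ≤ suc (dist y z)) where

  open Inverse vertex using (to; from; strictlyInverseˡ; strictlyInverseʳ)

  D : Digraph
  D = record { n = N ; adj = λ u v → adjV (to u) (to v) ; loopless = λ v → adjV-irrefl (to v) }

  -- Opaque, so that unification can read x off ⌜ x ⌝.
  opaque
    ⌜_⌝ : V → Fin N
    ⌜_⌝ = from

    to-⌜⌝ : ∀ x → to ⌜ x ⌝ ≡ x
    to-⌜⌝ = strictlyInverseˡ

    ⌜⌝-to : ∀ u → ⌜ to u ⌝ ≡ u
    ⌜⌝-to = strictlyInverseʳ

  ⌜⌝-injective : ∀ {x y} → ⌜ x ⌝ ≡ ⌜ y ⌝ → x ≡ y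
  ⌜⌝-injective {x} {y} ⌜x⌝≡⌜y⌝ = trans (sym (to-⌜⌝ x)) (trans (cong to ⌜x⌝≡⌜y⌝) (to-⌜⌝ y))

  ⌜⌝-≢ : ∀ {x y} → x ≢ y → ⌜ x ⌝ ≢ ⌜ y ⌝
  ⌜⌝-≢ x≢y = x≢y ∘ ⌜⌝-injective

  arc : ∀ {x y} → adjV x y ≡ true → Arc D ⌜ x ⌝ ⌜ y ⌝
  arc {x} {y} = subst₂ (λ a b → adjV a b ≡ true) (sym (to-⌜⌝ x)) (sym (to-⌜⌝ y))

  data Walkᵛ : V → List V → V → Set where
    stop : ∀ {x} → Walkᵛ x [] x
    step : ∀ {x w ws y} → adjV x w ≡ true → Walkᵛ w ws y → Walkᵛ x (w ∷ ws) y

  walk⌜⌝ : ∀ {x ws y} → Walkᵛ x ws y → Walk D ⌜ x ⌝ (map ⌜_⌝ ws) ⌜ y ⌝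
  walk⌜⌝ stop          = stop
  walk⌜⌝ (step xw walk) = step (arc xw) (walk⌜⌝ walk)

  walk-length≥dist : ∀ x y {ys} → Walk D ⌜ x ⌝ ys ⌜ y ⌝ → dist x y ≤ length ys
  walk-length≥dist x y walk =
    subst (_≤ _) (cong₂ dist (to-⌜⌝ x) (to-⌜⌝ y))
      (walk-length≥ (λ u v → dist (to u) (to v)) (λ v → dist-refl (to v))
                    (λ z xy → dist-arc _ _ (to z) xy) walk)

  cut-arc∈arcsOf⌜⌝ : (S : V → Bool) {p q : V} →
                     (∀ {a b} → adjV a b ≡ true → S a ≡ true → S b ≡ false → a ≡ p × b ≡ q) →
                     ∀ {x ys y} → Walk D ⌜ x ⌝ ys ⌜ y ⌝ → S x ≡ true → S y ≡ false →
                     (⌜ p ⌝ , ⌜ q ⌝) ∈ arcsOf ⌜ x ⌝ ys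
  cut-arc∈arcsOf⌜⌝ S {p} {q} leaving {x} {y = y} walk Sx Sy =
    cut-arc∈arcsOf (S ∘ to) leaving′ walk (trans (cong S (to-⌜⌝ x)) Sx)
                                          (trans (cong S (to-⌜⌝ y)) Sy)
    where
    leaving′ : ∀ {a b} → Arc D a b → S (to a) ≡ true → S (to b) ≡ false → (a , b) ≡ (⌜ p ⌝ , ⌜ q ⌝)
    leaving′ {a} {b} ab Sa Sb with leaving ab Sa Sb
    ... | refl , refl = cong₂ _,_ (sym (⌜⌝-to a)) (sym (⌜⌝-to b))

  mapArcs : ∀ {B : Set} → (V → V → B) → V → List V → List B
  mapArcs f x []       = []
  mapArcs f x (w ∷ ws) = f x w ∷ mapArcs f w ws

  interior : List V → List V
  interior []           = []
  interior (w ∷ [])     = []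
  interior (w ∷ x ∷ ws) = w ∷ interior (x ∷ ws)

  module Colouring {ka kv} (colA : V → V → Fin ka) (colV : V → Fin kv) where

    arcColouring : ArcColouring D ka
    arcColouring u v = colA (to u) (to v)

    vertexColouring : VertexColouring D kv
    vertexColouring u = colV (to u)

    mapArcs-⌜⌝ : ∀ x ws →
      map (λ uv → arcColouring (proj₁ uv) (proj₂ uv)) (arcsOf ⌜ x ⌝ (map ⌜_⌝ ws)) ≡ mapArcs colA x ws
    mapArcs-⌜⌝ x []       = refl
    mapArcs-⌜⌝ x (w ∷ ws) = cong₂ _∷_ (cong₂ colA (to-⌜⌝ x) (to-⌜⌝ w)) (mapArcs-⌜⌝ w ws)

    internal-⌜⌝ : ∀ ws → map vertexColouring (internal (map ⌜_⌝ ws)) ≡ map colV (interior ws)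
    internal-⌜⌝ []           = refl
    internal-⌜⌝ (w ∷ [])     = refl
    internal-⌜⌝ (w ∷ x ∷ ws) = cong₂ _∷_ (cong colV (to-⌜⌝ w)) (internal-⌜⌝ (x ∷ ws))

    -- The length is an index, not dist x y itself, so that a `with i ≟ j` on the goal
    -- Route x y (dist x y) also abstracts the test inside dist.
    record Route (x y : V) (ℓ : ℕ) : Set where
      constructor route
      field
        via           : List V
        walk          : Walkᵛ x via y
        distinct      : Unique (x ∷ via)
        length≡       : length via ≡ ℓ
        arcRainbow    : Unique (mapArcs colA x via)
        vertexRainbow : Unique (map colV (interior via))

    RainbowGeodesic : Fin N → Fin N → Set
    RainbowGeodesic u v = ∃ λ ys → IsGeodesic D u ys v × ArcRainbow {D} arcColouring u ys ×
                             VertexRainbow {D} vertexColouring ys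

    Route⇒RainbowGeodesic : ∀ {x y} → Route x y (dist x y) → RainbowGeodesic ⌜ x ⌝ ⌜ y ⌝
    Route⇒RainbowGeodesic {x} {y} (route via walk distinct length≡ arcRainbow vertexRainbow) =
      map ⌜_⌝ via ,
      ((walk⌜⌝ walk , Unique.map⁺ ⌜⌝-injective distinct) ,
       λ zs (walk′ , _) → subst (_≤ length zs) (trans (sym length≡) (sym (length-map ⌜_⌝ via)))
                                (walk-length≥dist x y walk′)) ,
      subst Unique (sym (mapArcs-⌜⌝ x via)) arcRainbow ,
      subst Unique (sym (internal-⌜⌝ via)) vertexRainbow

    module _ (routes : ∀ x y → Route x y (dist x y)) where

      rainbowGeodesic : ∀ u v → RainbowGeodesic u v
      rainbowGeodesic u v =
        subst₂ RainbowGeodesic (⌜⌝-to u) (⌜⌝-to v) (Route⇒RainbowGeodesic (routes (to u) (to v)))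

      arcColouring-strong : StronglyRainbowConnected D arcColouring
      arcColouring-strong u v with rainbowGeodesic u v
      ... | ys , geodesic , rainbow , _ = ys , geodesic , rainbow

      vertexColouring-strong : StronglyRainbowVertexConnected D vertexColouring
      vertexColouring-strong u v with rainbowGeodesic u v
      ... | ys , geodesic , _ , rainbow = ys , geodesic , rainbow

      stronglyConnected : StronglyConnected D
      stronglyConnected = rainbow⇒stronglyConnected (strong⇒rainbow arcColouring-strong)

module Windmill (t : ℕ) where

  m : ℕ
  m = 2 + t

  V : Set
  V = ⊤ ⊎ (Fin m ⊎ Fin m)

  pattern C   = inj₁ tt
  pattern A i = inj₂ (inj₁ i)
  pattern B i = inj₂ (inj₂ i)

  -- Opaque: unfolding it blows up the terms that with-abstraction has to inspect.
  opaque
    vertex : Fin (1 + (m + m)) ↔ V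
    vertex = (1↔⊤ ⊎-↔ +↔⊎) ↔-∘ +↔⊎

  adjV : V → V → Bool
  adjV C     (A _) = true
  adjV (A i) (B j) = does (i ≟ j)
  adjV (B _) C     = true
  adjV _     _     = false

  adjV-irrefl : ∀ v → adjV v v ≡ false
  adjV-irrefl C     = refl
  adjV-irrefl (A _) = refl
  adjV-irrefl (B _) = refl

  dist : V → V → ℕ
  dist C     C     = 0
  dist C     (A _) = 1
  dist C     (B _) = 2
  dist (A _) C     = 2
  dist (A i) (A j) = if does (i ≟ j) then 0 else 3
  dist (A i) (B j) = if does (i ≟ j) then 1 else 4
  dist (B _) C     = 1
  dist (B _) (A _) = 2
  dist (B i) (B j) = if does (i ≟ j) then 0 else 3

  dist-refl : ∀ v → dist v v ≡ 0
  dist-refl C     = refl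
  dist-refl (A i) rewrite dec-true (i ≟ i) refl = refl
  dist-refl (B i) rewrite dec-true (i ≟ i) refl = refl

  dist-arc : ∀ x y z → adjV x y ≡ true → dist x z ≤ suc (dist y z)
  dist-arc C (A k) C     _ = z≤n
  dist-arc C (A k) (A j) _ = s≤s z≤n
  dist-arc C (A k) (B j) _ with k ≟ j
  ... | yes _ = ≤ᵇ⇒≤ _ _ _
  ... | no  _ = ≤ᵇ⇒≤ _ _ _
  dist-arc (A k) (B k′) z _ with k ≟ k′
  dist-arc (A k) (B k) C     _ | yes refl = ≤ᵇ⇒≤ _ _ _
  dist-arc (A k) (B k) (A j) _ | yes refl with k ≟ j
  ... | yes _ = ≤ᵇ⇒≤ _ _ _
  ... | no  _ = ≤ᵇ⇒≤ _ _ _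
  dist-arc (A k) (B k) (B j) _ | yes refl with k ≟ j
  ... | yes _ = ≤ᵇ⇒≤ _ _ _
  ... | no  _ = ≤ᵇ⇒≤ _ _ _
  dist-arc (B k) C C     _ = ≤ᵇ⇒≤ _ _ _
  dist-arc (B k) C (A j) _ = ≤ᵇ⇒≤ _ _ _
  dist-arc (B k) C (B j) _ with k ≟ j
  ... | yes _ = ≤ᵇ⇒≤ _ _ _
  ... | no  _ = ≤ᵇ⇒≤ _ _ _

  open Presentation vertex adjV adjV-irrefl dist dist-refl dist-arc public

  colA : V → V → Fin (2 + m)
  colA (B _) C     = 0F
  colA C     (A _) = 1F
  colA (A i) (B _) = suc (suc i)
  colA _     _     = 0F

  colV : V → Fin 3
  colV C     = 0F
  colV (A _) = 1F
  colV (B _) = 2F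

  open Colouring colA colV public

  A≢A : ∀ {i j} → i ≢ j → (V ∋ A i) ≢ A j
  A≢A i≢j refl = i≢j refl

  B≢B : ∀ {i j} → i ≢ j → (V ∋ B i) ≢ B j
  B≢B i≢j refl = i≢j refl

  A→B : ∀ i → adjV (A i) (B i) ≡ true
  A→B i = dec-true (i ≟ i) refl

  routes : ∀ x y → Route x y (dist x y)
  routes C C = route [] stop ([] ∷ []) refl [] []
  routes C (A j) = route (A j ∷ []) (step refl stop)
    (((λ ()) ∷ []) ∷ [] ∷ []) refl ([] ∷ []) []
  routes C (B j) = route (A j ∷ B j ∷ []) (step refl (step (A→B j) stop))
    (((λ ()) ∷ (λ ()) ∷ []) ∷ ((λ ()) ∷ []) ∷ [] ∷ []) refl
    (((λ ()) ∷ []) ∷ [] ∷ []) ([] ∷ [])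
  routes (A i) C = route (B i ∷ C ∷ []) (step (A→B i) (step refl stop))
    (((λ ()) ∷ (λ ()) ∷ []) ∷ ((λ ()) ∷ []) ∷ [] ∷ []) refl
    (((λ ()) ∷ []) ∷ [] ∷ []) ([] ∷ [])
  routes (A i) (A j) with i ≟ j
  ... | yes refl = route [] stop ([] ∷ []) refl [] []
  ... | no i≢j = route (B i ∷ C ∷ A j ∷ [])
    (step (A→B i) (step refl (step refl stop)))
    (((λ ()) ∷ (λ ()) ∷ A≢A i≢j ∷ []) ∷ ((λ ()) ∷ (λ ()) ∷ []) ∷ ((λ ()) ∷ []) ∷ [] ∷ []) refl
    (((λ ()) ∷ (λ ()) ∷ []) ∷ ((λ ()) ∷ []) ∷ [] ∷ []) (((λ ()) ∷ []) ∷ [] ∷ [])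
  routes (A i) (B j) with i ≟ j
  ... | yes refl = route (B i ∷ []) (step (A→B i) stop)
    (((λ ()) ∷ []) ∷ [] ∷ []) refl ([] ∷ []) []
  ... | no i≢j = route (B i ∷ C ∷ A j ∷ B j ∷ [])
    (step (A→B i) (step refl (step refl (step (A→B j) stop))))
    (((λ ()) ∷ (λ ()) ∷ A≢A i≢j ∷ (λ ()) ∷ []) ∷ ((λ ()) ∷ (λ ()) ∷ B≢B i≢j ∷ []) ∷
     ((λ ()) ∷ (λ ()) ∷ []) ∷ ((λ ()) ∷ []) ∷ [] ∷ [])
    refl
    (((λ ()) ∷ (λ ()) ∷ (λ { refl → i≢j refl }) ∷ []) ∷ ((λ ()) ∷ (λ ()) ∷ []) ∷ ((λ ()) ∷ []) ∷ [] ∷ [])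
    (((λ ()) ∷ (λ ()) ∷ []) ∷ ((λ ()) ∷ []) ∷ [] ∷ [])
  routes (B i) C = route (C ∷ []) (step refl stop)
    (((λ ()) ∷ []) ∷ [] ∷ []) refl ([] ∷ []) []
  routes (B i) (A j) = route (C ∷ A j ∷ []) (step refl (step refl stop))
    (((λ ()) ∷ (λ ()) ∷ []) ∷ ((λ ()) ∷ []) ∷ [] ∷ []) refl
    (((λ ()) ∷ []) ∷ [] ∷ []) ([] ∷ [])
  routes (B i) (B j) with i ≟ j
  ... | yes refl = route [] stop ([] ∷ []) refl [] []
  ... | no i≢j = route (C ∷ A j ∷ B j ∷ [])
    (step refl (step refl (step (A→B j) stop)))
    (((λ ()) ∷ (λ ()) ∷ B≢B i≢j ∷ []) ∷ ((λ ()) ∷ (λ ()) ∷ []) ∷ ((λ ()) ∷ []) ∷ [] ∷ []) refl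
    (((λ ()) ∷ (λ ()) ∷ []) ∷ ((λ ()) ∷ []) ∷ [] ∷ []) (((λ ()) ∷ []) ∷ [] ∷ [])

  isA isB petal : Fin m → V → Bool
  isA i (A k) = does (i ≟ k)
  isA i _     = false
  isB i (B k) = does (i ≟ k)
  isB i _     = false
  petal i C     = false
  petal i (A k) = does (i ≟ k)
  petal i (B k) = does (i ≟ k)

  leaving-A : ∀ i {a b} → adjV a b ≡ true → isA i a ≡ true → isA i b ≡ false → a ≡ A i × b ≡ B i
  leaving-A i {A k} {B k′} ab _ _ with i ≟ k | k ≟ k′
  ... | yes refl | yes refl = refl , refl

  leaving-petal : ∀ i {a b} → adjV a b ≡ true → petal i a ≡ true → petal i b ≡ false → a ≡ B i × b ≡ C
  leaving-petal i {A k} {B k′} _ _  _  with k ≟ k′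
  leaving-petal i {A k} {B k}  _ Sa Sb | yes refl with () ← trans (sym Sa) Sb
  leaving-petal i {B k} {C} _ _ _ with i ≟ k
  ... | yes refl = refl , refl

  entering-petal : ∀ j {a b} → adjV a b ≡ true → not (petal j a) ≡ true → not (petal j b) ≡ false →
                   a ≡ C × b ≡ A j
  entering-petal j {C} {A k} _ _ _ with j ≟ k
  ... | yes refl = refl , refl
  entering-petal j {A k} {B k′} _ _  _  with k ≟ k′
  entering-petal j {A k} {B k}  _ Sa Sb | yes refl with () ← trans (sym Sa) Sb

  entering-B : ∀ j {a b} → adjV a b ≡ true → not (isB j a) ≡ true → not (isB j b) ≡ false →
               a ≡ A j × b ≡ B j
  entering-B j {A k} {B k′} _ _ _ with j ≟ k′ | k ≟ k′
  ... | yes refl | yes refl = refl , refl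

  petal-walk-arcs : ∀ {i j ys} → i ≢ j → Walk D ⌜ A i ⌝ ys ⌜ B j ⌝ →
    All (_∈ arcsOf ⌜ A i ⌝ ys)
        ((⌜ A i ⌝ , ⌜ B i ⌝) ∷ (⌜ B i ⌝ , ⌜ C ⌝) ∷ (⌜ C ⌝ , ⌜ A j ⌝) ∷ (⌜ A j ⌝ , ⌜ B j ⌝) ∷ [])
  petal-walk-arcs {i} {j} i≢j walk =
    cut-arc∈arcsOf⌜⌝ (isA i) (leaving-A i) walk (dec-true (i ≟ i) refl) refl ∷
    cut-arc∈arcsOf⌜⌝ (petal i) (leaving-petal i) walk (dec-true (i ≟ i) refl) (dec-false (i ≟ j) i≢j) ∷
    cut-arc∈arcsOf⌜⌝ (not ∘ petal j) (entering-petal j) walk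
      (cong not (dec-false (j ≟ i) (≢-sym i≢j))) (cong not (dec-true (j ≟ j) refl)) ∷
    cut-arc∈arcsOf⌜⌝ (not ∘ isB j) (entering-B j) walk refl (cong not (dec-true (j ≟ j) refl)) ∷ []

  rc≥2+m : ∀ {k} (c : ArcColouring D k) → RainbowConnected D c → 2 + m ≤ k
  rc≥2+m {k} c rainbow = ≢-preserving⇒≤ f f-≢
    where
    col : V → V → Fin k
    col x y = c ⌜ x ⌝ ⌜ y ⌝

    petal-colours : ∀ {i j} → i ≢ j →
      Unique (col (A i) (B i) ∷ col (B i) C ∷ col C (A j) ∷ col (A j) (B j) ∷ [])
    petal-colours {i} {j} i≢j with rainbow ⌜ A i ⌝ ⌜ B j ⌝
    ... | _ , (walk , _) , walk-rainbow =
      Unique-map-restrict walk-rainbow (petal-walk-arcs i≢j walk) (AllPairs.map (λ t≢t′ → t≢t′ ∘ cong proj₁)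
        ((⌜⌝-≢ (λ ()) ∷ ⌜⌝-≢ (λ ()) ∷ ⌜⌝-≢ (A≢A i≢j) ∷ []) ∷
         (⌜⌝-≢ (λ ()) ∷ ⌜⌝-≢ (λ ()) ∷ []) ∷ (⌜⌝-≢ (λ ()) ∷ []) ∷ [] ∷ []))

    -- Any two of these arcs lie on a common walk Aᵢ → Bⱼ with i ≠ j.
    f : Fin (2 + m) → Fin k
    f 0F            = col (B 0F) C
    f 1F            = col C (A 1F)
    f (suc (suc i)) = col (A i) (B i)

    B₀C≢CA₁ : f 0F ≢ f 1F
    B₀C≢CA₁ with petal-colours {0F} {1F} (λ ())
    ... | _ ∷ (b≢c ∷ _) ∷ _ = b≢c

    B₀C≢AB : ∀ j → f 0F ≢ f (suc (suc j))
    B₀C≢AB j with j ≟ 0F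
    ... | yes refl with petal-colours {0F} {1F} (λ ())
    ...   | (a≢b ∷ _) ∷ _ = ≢-sym a≢b
    B₀C≢AB j | no j≢0 with petal-colours {0F} {j} (≢-sym j≢0)
    ...   | _ ∷ (_ ∷ b≢d ∷ _) ∷ _ = b≢d

    CA₁≢AB : ∀ j → f 1F ≢ f (suc (suc j))
    CA₁≢AB j with j ≟ 1F
    ... | yes refl with petal-colours {0F} {1F} (λ ())
    ...   | _ ∷ _ ∷ (c≢d ∷ _) ∷ _ = c≢d
    CA₁≢AB j | no j≢1 with petal-colours {j} {1F} j≢1
    ...   | (_ ∷ a≢c ∷ _) ∷ _ = ≢-sym a≢c

    AB≢AB : ∀ {i j} → i ≢ j → f (suc (suc i)) ≢ f (suc (suc j))
    AB≢AB i≢j with petal-colours i≢j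
    ... | (_ ∷ _ ∷ a≢d ∷ _) ∷ _ = a≢d

    f-≢ : ∀ {p q} → p ≢ q → f p ≢ f q
    f-≢ {0F}          {0F}          p≢q = ⊥-elim (p≢q refl)
    f-≢ {0F}          {1F}          _   = B₀C≢CA₁
    f-≢ {0F}          {suc (suc j)} _   = B₀C≢AB j
    f-≢ {1F}          {0F}          _   = ≢-sym B₀C≢CA₁
    f-≢ {1F}          {1F}          p≢q = ⊥-elim (p≢q refl)
    f-≢ {1F}          {suc (suc j)} _   = CA₁≢AB j
    f-≢ {suc (suc i)} {0F}          _   = ≢-sym (B₀C≢AB i)
    f-≢ {suc (suc i)} {1F}          _   = ≢-sym (CA₁≢AB i)
    f-≢ {suc (suc i)} {suc (suc j)} p≢q = AB≢AB (p≢q ∘ cong (λ i → suc (suc i)))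

  rvc≥3 : ∀ {k} (c : VertexColouring D k) → RainbowVertexConnected D c → 3 ≤ k
  rvc≥3 = rainbowVertex-colours≥ (walk-length≥dist (A 0F) (B 1F))

  rc≡src≡2+m : rc≡ D (2 + m) × src≡ D (2 + m)
  rc≡src≡2+m = rc≡∧src≡ arcColouring (arcColouring-strong routes) rc≥2+m

  rvc≡srvc≡3 : rvc≡ D 3 × srvc≡ D 3
  rvc≡srvc≡3 = rvc≡∧srvc≡ vertexColouring (vertexColouring-strong routes) rvc≥3

module Corona (t : ℕ) where

  s : ℕ
  s = 2 + t

  V : Set
  V = Fin s ⊎ Fin s

  pattern X i = inj₁ i
  pattern L i = inj₂ i

  vertex : Fin (s + s) ↔ V
  vertex = +↔⊎

  adjV : V → V → Bool
  adjV (X i) (X j) = not (does (i ≟ j))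
  adjV (X i) (L j) = does (i ≟ j)
  adjV (L i) (X j) = does (i ≟ j)
  adjV (L _) (L _) = false

  adjV-irrefl : ∀ v → adjV v v ≡ false
  adjV-irrefl (X i) = cong not (dec-true (i ≟ i) refl)
  adjV-irrefl (L _) = refl

  dist : V → V → ℕ
  dist (X i) (X j) = if does (i ≟ j) then 0 else 1
  dist (X i) (L j) = if does (i ≟ j) then 1 else 2
  dist (L i) (X j) = if does (i ≟ j) then 1 else 2
  dist (L i) (L j) = if does (i ≟ j) then 0 else 3

  dist-refl : ∀ v → dist v v ≡ 0
  dist-refl (X i) rewrite dec-true (i ≟ i) refl = refl
  dist-refl (L i) rewrite dec-true (i ≟ i) refl = refl

  dist-arc : ∀ x y z → adjV x y ≡ true → dist x z ≤ suc (dist y z)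
  dist-arc (X k) (X k′) (X j) _ with k ≟ j | k′ ≟ j
  ... | yes _ | _     = z≤n
  ... | no  _ | yes _ = ≤ᵇ⇒≤ _ _ _
  ... | no  _ | no  _ = ≤ᵇ⇒≤ _ _ _
  dist-arc (X k) (X k′) (L j) _ with k ≟ j | k′ ≟ j
  ... | yes _ | yes _ = ≤ᵇ⇒≤ _ _ _
  ... | yes _ | no  _ = ≤ᵇ⇒≤ _ _ _
  ... | no  _ | yes _ = ≤ᵇ⇒≤ _ _ _
  ... | no  _ | no  _ = ≤ᵇ⇒≤ _ _ _
  dist-arc (X k) (L k′) z _ with k ≟ k′
  dist-arc (X k) (L k) (X j) _ | yes refl with k ≟ j
  ... | yes _ = ≤ᵇ⇒≤ _ _ _
  ... | no  _ = ≤ᵇ⇒≤ _ _ _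
  dist-arc (X k) (L k) (L j) _ | yes refl with k ≟ j
  ... | yes _ = ≤ᵇ⇒≤ _ _ _
  ... | no  _ = ≤ᵇ⇒≤ _ _ _
  dist-arc (L k) (X k′) z _ with k ≟ k′
  dist-arc (L k) (X k) (X j) _ | yes refl with k ≟ j
  ... | yes _ = ≤ᵇ⇒≤ _ _ _
  ... | no  _ = ≤ᵇ⇒≤ _ _ _
  dist-arc (L k) (X k) (L j) _ | yes refl with k ≟ j
  ... | yes _ = ≤ᵇ⇒≤ _ _ _
  ... | no  _ = ≤ᵇ⇒≤ _ _ _

  open Presentation vertex adjV adjV-irrefl dist dist-refl dist-arc public

  colA : V → V → Fin 3
  colA (L _) (X _) = 0F
  colA (X _) (X _) = 1F
  colA (X _) (L _) = 2F
  colA (L _) (L _) = 0F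

  colV : V → Fin s
  colV (X i) = i
  colV (L i) = i

  open Colouring colA colV public

  X≢X : ∀ {i j} → i ≢ j → (V ∋ X i) ≢ X j
  X≢X i≢j refl = i≢j refl

  L≢L : ∀ {i j} → i ≢ j → (V ∋ L i) ≢ L j
  L≢L i≢j refl = i≢j refl

  X→L : ∀ i → adjV (X i) (L i) ≡ true
  X→L i = dec-true (i ≟ i) refl

  L→X : ∀ i → adjV (L i) (X i) ≡ true
  L→X i = dec-true (i ≟ i) refl

  X→X : ∀ {i j} → i ≢ j → adjV (X i) (X j) ≡ true
  X→X {i} {j} i≢j = cong not (dec-false (i ≟ j) i≢j)

  routes : ∀ x y → Route x y (dist x y)
  routes (X i) (X j) with i ≟ j
  ... | yes refl = route [] stop ([] ∷ []) refl [] []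
  ... | no i≢j = route (X j ∷ []) (step (X→X i≢j) stop)
    ((X≢X i≢j ∷ []) ∷ [] ∷ []) refl ([] ∷ []) []
  routes (X i) (L j) with i ≟ j
  ... | yes refl = route (L i ∷ []) (step (X→L i) stop)
    (((λ ()) ∷ []) ∷ [] ∷ []) refl ([] ∷ []) []
  ... | no i≢j = route (X j ∷ L j ∷ []) (step (X→X i≢j) (step (X→L j) stop))
    ((X≢X i≢j ∷ (λ ()) ∷ []) ∷ ((λ ()) ∷ []) ∷ [] ∷ []) refl
    (((λ ()) ∷ []) ∷ [] ∷ []) ([] ∷ [])
  routes (L i) (X j) with i ≟ j
  ... | yes refl = route (X i ∷ []) (step (L→X i) stop)
    (((λ ()) ∷ []) ∷ [] ∷ []) refl ([] ∷ []) []
  ... | no i≢j = route (X i ∷ X j ∷ []) (step (L→X i) (step (X→X i≢j) stop))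
    (((λ ()) ∷ (λ ()) ∷ []) ∷ (X≢X i≢j ∷ []) ∷ [] ∷ []) refl
    (((λ ()) ∷ []) ∷ [] ∷ []) ([] ∷ [])
  routes (L i) (L j) with i ≟ j
  ... | yes refl = route [] stop ([] ∷ []) refl [] []
  ... | no i≢j = route (X i ∷ X j ∷ L j ∷ []) (step (L→X i) (step (X→X i≢j) (step (X→L j) stop)))
    (((λ ()) ∷ (λ ()) ∷ L≢L i≢j ∷ []) ∷ (X≢X i≢j ∷ (λ ()) ∷ []) ∷ ((λ ()) ∷ []) ∷ [] ∷ []) refl
    (((λ ()) ∷ (λ ()) ∷ []) ∷ ((λ ()) ∷ []) ∷ [] ∷ []) ((i≢j ∷ []) ∷ [] ∷ [])

  isL : Fin s → V → Bool
  isL i (L k) = does (i ≟ k)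
  isL i (X _) = false

  leaving-L : ∀ i {a b} → adjV a b ≡ true → isL i a ≡ true → isL i b ≡ false → a ≡ L i × b ≡ X i
  leaving-L i {L k} {X k′} _ _ _ with i ≟ k | k ≟ k′
  ... | yes refl | yes refl = refl , refl

  entering-L : ∀ j {a b} → adjV a b ≡ true → not (isL j a) ≡ true → not (isL j b) ≡ false →
               a ≡ X j × b ≡ L j
  entering-L j {X k} {L k′} _ _ _ with j ≟ k′ | k ≟ k′
  ... | yes refl | yes refl = refl , refl

  hubs-internal : ∀ {i j ys} → i ≢ j → Walk D ⌜ L i ⌝ ys ⌜ L j ⌝ →
                  ⌜ X i ⌝ ∈ internal ys × ⌜ X j ⌝ ∈ internal ys
  hubs-internal {i} {j} i≢j walk =
    head∈internal walk (cut-arc∈arcsOf⌜⌝ (isL i) (leaving-L i) walk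
                         (dec-true (i ≟ i) refl) (dec-false (i ≟ j) i≢j))
                  (⌜⌝-≢ (λ ())) ,
    tail∈internal _ (cut-arc∈arcsOf⌜⌝ (not ∘ isL j) (entering-L j) walk
                       (cong not (dec-false (j ≟ i) (≢-sym i≢j))) (cong not (dec-true (j ≟ j) refl)))
                  (⌜⌝-≢ (λ ()))

  rc≥3 : ∀ {k} (c : ArcColouring D k) → RainbowConnected D c → 3 ≤ k
  rc≥3 = rainbow-colours≥ (walk-length≥dist (L 0F) (L 1F))

  rvc≥s : ∀ {k} (c : VertexColouring D k) → RainbowVertexConnected D c → s ≤ k
  rvc≥s c rainbow = ≢-preserving⇒≤ (λ i → c ⌜ X i ⌝) X-colours-≢
    where
    X-colours-≢ : ∀ {i j} → i ≢ j → c ⌜ X i ⌝ ≢ c ⌜ X j ⌝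
    X-colours-≢ {i} {j} i≢j with rainbow ⌜ L i ⌝ ⌜ L j ⌝
    ... | _ , (walk , _) , walk-rainbow with hubs-internal i≢j walk
    ...   | Xi∈ , Xj∈ = Unique-map⇒≢ walk-rainbow Xi∈ Xj∈ (⌜⌝-≢ (X≢X i≢j))

  rc≡src≡3 : rc≡ D 3 × src≡ D 3
  rc≡src≡3 = rc≡∧src≡ arcColouring (arcColouring-strong routes) rc≥3

  rvc≡srvc≡s : rvc≡ D s × srvc≡ D s
  rvc≡srvc≡s = rvc≡∧srvc≡ vertexColouring (vertexColouring-strong routes) rvc≥s

lemma6 : (∀ (s : ℕ) → 4 ≤ s → Σ Digraph λ D → StronglyConnected D × (∃ λ k → s ≤ k × rc≡ D k × src≡ D k) × rvc≡ D 3 × srvc≡ D 3)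
    × (∀ (s : ℕ) → 2 ≤ s → Σ Digraph λ D → StronglyConnected D × rc≡ D 3 × src≡ D 3 × rvc≡ D s × srvc≡ D s)
lemma6 = windmill , corona
  where
  windmill : ∀ (s : ℕ) → 4 ≤ s → Σ Digraph λ D → StronglyConnected D × (∃ λ k → s ≤ k × rc≡ D k × src≡ D k) × rvc≡ D 3 × srvc≡ D 3
  windmill (suc (suc t)) (s≤s (s≤s _)) =
    D , stronglyConnected routes , (2 + m , m≤n+m m 2 , rc≡src≡2+m) , rvc≡srvc≡3
    where open Windmill t

  corona : ∀ (s : ℕ) → 2 ≤ s → Σ Digraph λ D → StronglyConnected D × rc≡ D 3 × src≡ D 3 × rvc≡ D s × srvc≡ D s
  corona (suc (suc t)) (s≤s (s≤s _)) =
    D , stronglyConnected routes , proj₁ rc≡src≡3 , proj₂ rc≡src≡3 , rvc≡srvc≡s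
    where open Corona t
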